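{- Let $s,t\ge 1$ and $r\ge 3$ be integers with $r<s+t$, and let $G=K_s\,\dot\cup\,K_t$ be the disjoint union of complete graphs of orders $s$ and $t$. Then $G$ is $r$-neutral if $r$ is even, $G$ is $r$-void if $r\equiv 1\pmod 4$, and $G$ is $r$-complete if $r\equiv 3\pmod 4$.
   Context: For a graph $G$ of order $n$ and an integer $r$ with $2<r\le n$: $G$ is called $r$-complete if every subgraph of $G$ induced by $r$ vertices has an odd number of edges; $r$-void if every subgraph induced by $r$ vertices has an even number of edges; and $r$-neutral if it is neither $r$-complete nor $r$-void. -}

module Defs where

open import Data.Nat using (ℕ; zero; suc; _+_; _<ᵇ_; _%_)
open import Data.Bool using (Bool; true; false; _∧_; not)
open import Data.Fin using (Fin; toℕ; _≟_)
open import Data.Fin.Subset using (Subset; ∣_∣)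
open import Data.Vec using (lookup)
open import Data.List using (List; map; allFin)
open import Data.Nat.ListAction using (sum)
open import Data.Product using (_×_)
open import Relation.Binary.PropositionalEquality using (_≡_; refl; cong₂) renaming (sym to ≡-sym)
open import Relation.Nullary using (yes; no)
import Data.Empty
open import Relation.Nullary using (¬_)
open import Relation.Nullary.Decidable using (⌊_⌋)

record Graph (n : ℕ) : Set where
  field
    adj   : Fin n → Fin n → Bool
    symm  : ∀ i j → adj i j ≡ adj j i
    irrefl : ∀ i → adj i i ≡ false
open Graph public

indicator : Bool → ℕ
indicator true  = 1
indicator false = 0

edgesIn : ∀ {n} → Graph n → Subset n → ℕ
edgesIn {n} G S =
  sum (map (λ i → sum (map (λ j →
    indicator ((toℕ i <ᵇ toℕ j) ∧ lookup S i ∧ lookup S j ∧ adj G i j))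
      (allFin n))) (allFin n))

Odd : ℕ → Set
Odd m = m % 2 ≡ 1

Even : ℕ → Set
Even m = m % 2 ≡ 0

IsComplete : ∀ {n} → ℕ → Graph n → Set
IsComplete r G = ∀ S → ∣ S ∣ ≡ r → Odd (edgesIn G S)

IsVoid : ∀ {n} → ℕ → Graph n → Set
IsVoid r G = ∀ S → ∣ S ∣ ≡ r → Even (edgesIn G S)

IsNeutral : ∀ {n} → ℕ → Graph n → Set
IsNeutral r G = ¬ IsComplete r G × ¬ IsVoid r G

-- K_s ∪̇ K_t on Fin (s + t): vertices with index < s form K_s, the rest K_t;
-- distinct vertices are adjacent iff they lie in the same part.
_xor_ : Bool → Bool → Bool
true  xor y = not y
false xor y = y

xor-comm : ∀ x y → x xor y ≡ y xor x
xor-comm true true = refl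
xor-comm true false = refl
xor-comm false true = refl
xor-comm false false = refl

sameSide : ℕ → ℕ → ℕ → Bool
sameSide s a b = not ((a <ᵇ s) xor (b <ᵇ s))

adjKK : ∀ s t → Fin (s + t) → Fin (s + t) → Bool
adjKK s t i j = not ⌊ i ≟ j ⌋ ∧ sameSide s (toℕ i) (toℕ j)


private
  eqb-sym : ∀ {m} (i j : Fin m) → ⌊ i ≟ j ⌋ ≡ ⌊ j ≟ i ⌋
  eqb-sym i j with i ≟ j | j ≟ i
  ... | yes _ | yes _ = refl
  ... | no _ | no _ = refl
  ... | yes p | no q = Data.Empty.⊥-elim (q (≡-sym p))
  ... | no p | yes q = Data.Empty.⊥-elim (p (≡-sym q))

  eqb-refl : ∀ {m} (i : Fin m) → ⌊ i ≟ i ⌋ ≡ true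
  eqb-refl i with i ≟ i
  ... | yes _ = refl
  ... | no p = Data.Empty.⊥-elim (p refl)

  irr : ∀ s t (i : Fin (s + t)) → adjKK s t i i ≡ false
  irr s t i with i ≟ i
  ... | yes _ = refl
  ... | no p = Data.Empty.⊥-elim (p refl)

K⊎K : (s t : ℕ) → Graph (s + t)
K⊎K s t = record
  { adj = adjKK s t
  ; symm = λ i j → cong₂ (λ a b → not a ∧ not b) (eqb-sym i j)
                    (xor-comm (toℕ i <ᵇ s) (toℕ j <ᵇ s))
  ; irrefl = irr s t
  }

{-# OPTIONS --safe #-}

-- An r-set S splits as U ∪ V with U ⊆ K_s and V ⊆ K_t; if |U| = a and |V| = b, then S induces
-- K_a ∪̇ K_b, with C(a,2) + C(b,2) = C(r,2) − ab edges. For odd r one of a, b is even, so the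
-- parity is that of C(r,2), which only depends on r mod 4. For even r, the splits (a+1, b) and
-- (a, b+1) with a + b = r − 1 give C(a,2) + C(b,2) + a and C(a,2) + C(b,2) + b edges, and these
-- have opposite parities because a + b is odd.
module Submission where

open import Defs
open import Data.Nat using (ℕ; zero; suc; _+_; _*_; _≤_; _<_; _%_; _<ᵇ_; z≤n; s≤s; s≤s⁻¹; parity)
open import Data.Nat.Properties
  using (+-0-commutativeMonoid; +-assoc; +-comm; +-suc; +-identityʳ; m≤n⇒m≤1+n; ≤-trans)
open import Data.Nat.Combinatorics using (_C_; nC1≡n; nCk+nC[k+1]≡[n+1]C[k+1])
open import Data.Nat.Tactic.RingSolver using (solve-∀)
import Data.Nat.ListAction as List
open import Data.Parity.Base using (Parity; 0ℙ; 1ℙ; _⁻¹) renaming (_+_ to _⊕_; _*_ to _⊛_)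
open import Data.Parity.Properties using (+-homo-+; *-homo-*; suc-homo-⁻¹; ⁻¹-involutive)
  renaming (+-identityʳ to ⊕-identityʳ)
open import Algebra.Properties.CommutativeMonoid.Sum +-0-commutativeMonoid
  using (sum-syntax; sum-cong-≗; sum-replicate-zero)
open import Data.Bool using (Bool; true; false; _∧_; not)
open import Data.Bool.Properties using (not-involutive; ∧-zeroʳ; ∧-identityʳ)
open import Data.Fin using (Fin; zero; suc; toℕ; _≟_)
open import Data.Fin.Subset using (Subset; ∣_∣; inside; outside; ⊥)
open import Data.Fin.Subset.Properties using (∣⊥∣≡0)
open import Data.Vec using ([]; _∷_; _++_; lookup; splitAt)
open import Data.List using (map; tabulate; allFin)
open import Data.List.Properties using (map-tabulate)
open import Data.Product using (Σ; ∃₂; _×_; _,_)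
open import Function using (id; _∘_; _⇔_; mk⇔; Equivalence)
open import Relation.Binary.PropositionalEquality
  using (_≡_; refl; sym; trans; cong; cong₂; subst; module ≡-Reasoning)
open import Relation.Nullary using (¬_; yes; no; contradiction)

open Equivalence using (to; from)
open ≡-Reasoning

sum-map-allFin : ∀ n (f : Fin n → ℕ) → List.sum (map f (allFin n)) ≡ ∑[ i < n ] f i
sum-map-allFin n f = trans (cong List.sum (map-tabulate id f)) (sum-tabulate f)
  where
  sum-tabulate : ∀ {n} (f : Fin n → ℕ) → List.sum (tabulate f) ≡ ∑[ i < n ] f i
  sum-tabulate {zero}  f = refl
  sum-tabulate {suc n} f = cong (f zero +_) (sum-tabulate (f ∘ suc))

count : ∀ {n} → (Fin n → Bool) → ℕ
count {n} p = ∑[ i < n ] indicator (p i)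

∣p∣≡count : ∀ {n} (p : Subset n) → ∣ p ∣ ≡ count (lookup p)
∣p∣≡count []            = refl
∣p∣≡count (inside  ∷ p) = cong suc (∣p∣≡count p)
∣p∣≡count (outside ∷ p) = ∣p∣≡count p

∣x∷p∣ : ∀ {n} x (p : Subset n) → ∣ x ∷ p ∣ ≡ indicator x + ∣ p ∣
∣x∷p∣ inside  p = refl
∣x∷p∣ outside p = refl

∣p++q∣ : ∀ {m n} (p : Subset m) (q : Subset n) → ∣ p ++ q ∣ ≡ ∣ p ∣ + ∣ q ∣
∣p++q∣ []      q = refl
∣p++q∣ (x ∷ p) q = begin
  ∣ x ∷ (p ++ q) ∣            ≡⟨ ∣x∷p∣ x (p ++ q) ⟩
  indicator x + ∣ p ++ q ∣    ≡⟨ cong (indicator x +_) (∣p++q∣ p q) ⟩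
  indicator x + (∣ p ∣ + ∣ q ∣) ≡⟨ +-assoc (indicator x) _ _ ⟨
  indicator x + ∣ p ∣ + ∣ q ∣   ≡⟨ cong (_+ ∣ q ∣) (∣x∷p∣ x p) ⟨
  ∣ x ∷ p ∣ + ∣ q ∣            ∎

subset-of-size : ∀ {k n} → k ≤ n → Σ (Subset n) λ p → ∣ p ∣ ≡ k
subset-of-size {n = n} z≤n   = ⊥ , ∣⊥∣≡0 n
subset-of-size (s≤s k≤n) with subset-of-size k≤n
... | p , ∣p∣≡k = inside ∷ p , cong suc ∣p∣≡k

[1+n]C2 : ∀ n → suc n C 2 ≡ n + n C 2
[1+n]C2 n = trans (sym (nCk+nC[k+1]≡[n+1]C[k+1] n 1)) (cong (_+ n C 2) (nC1≡n n))

[m+n]C2 : ∀ m n → (m + n) C 2 ≡ m C 2 + n C 2 + m * n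
[m+n]C2 zero    n = sym (+-identityʳ (n C 2))
[m+n]C2 (suc m) n = begin
  suc (m + n) C 2                   ≡⟨ [1+n]C2 (m + n) ⟩
  m + n + (m + n) C 2               ≡⟨ cong (m + n +_) ([m+n]C2 m n) ⟩
  m + n + (m C 2 + n C 2 + m * n)   ≡⟨ regroup m n (m C 2) (n C 2) ⟩
  m + m C 2 + n C 2 + (n + m * n)   ≡⟨ cong (λ x → x + n C 2 + suc m * n) ([1+n]C2 m) ⟨
  suc m C 2 + n C 2 + suc m * n     ∎
  where
  regroup : ∀ m n a b → m + n + (a + b + m * n) ≡ m + a + b + (n + m * n)
  regroup = solve-∀

Even⇔parity≡0ℙ : ∀ m → Even m ⇔ parity m ≡ 0ℙ
Even⇔parity≡0ℙ 0             = mk⇔ (λ _ → refl) (λ _ → refl)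
Even⇔parity≡0ℙ 1             = mk⇔ (λ ()) (λ ())
Even⇔parity≡0ℙ (suc (suc m)) = Even⇔parity≡0ℙ m

Odd⇔parity≡1ℙ : ∀ m → Odd m ⇔ parity m ≡ 1ℙ
Odd⇔parity≡1ℙ 0             = mk⇔ (λ ()) (λ ())
Odd⇔parity≡1ℙ 1             = mk⇔ (λ _ → refl) (λ _ → refl)
Odd⇔parity≡1ℙ (suc (suc m)) = Odd⇔parity≡1ℙ m

4-periodic⇒≡%4 : ∀ {A : Set} (f : ℕ → A) → (∀ n → f (4 + n) ≡ f n) → ∀ n → f n ≡ f (n % 4)
4-periodic⇒≡%4 f periodic 0 = refl
4-periodic⇒≡%4 f periodic 1 = refl
4-periodic⇒≡%4 f periodic 2 = refl
4-periodic⇒≡%4 f periodic 3 = refl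
4-periodic⇒≡%4 f periodic (suc (suc (suc (suc n)))) =
  trans (periodic n) (4-periodic⇒≡%4 f periodic n)

-- C(4,2) = 6 and 4n are even.
parity-[4+n]C2 : ∀ n → parity ((4 + n) C 2) ≡ parity (n C 2)
parity-[4+n]C2 n = begin
  parity ((4 + n) C 2)                              ≡⟨ cong parity ([m+n]C2 4 n) ⟩
  parity (4 C 2 + n C 2 + 4 * n)                    ≡⟨ +-homo-+ (4 C 2 + n C 2) (4 * n) ⟩
  parity (4 C 2 + n C 2) ⊕ parity (4 * n)           ≡⟨ cong₂ _⊕_ (+-homo-+ (4 C 2) (n C 2)) (*-homo-* 4 n) ⟩
  parity (4 C 2) ⊕ parity (n C 2) ⊕ (parity 4 ⊛ parity n) ≡⟨ ⊕-identityʳ (parity (n C 2)) ⟩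
  parity (n C 2)                                    ∎

⊕≡1ℙ⇒⊛≡0ℙ : ∀ (p q : Parity) → p ⊕ q ≡ 1ℙ → p ⊛ q ≡ 0ℙ
⊕≡1ℙ⇒⊛≡0ℙ 0ℙ q  _ = refl
⊕≡1ℙ⇒⊛≡0ℙ 1ℙ 0ℙ _ = refl

[p⊕x]⊕[p⊕y]≡x⊕y : ∀ (p x y : Parity) → (p ⊕ x) ⊕ (p ⊕ y) ≡ x ⊕ y
[p⊕x]⊕[p⊕y]≡x⊕y 0ℙ x  y = refl
[p⊕x]⊕[p⊕y]≡x⊕y 1ℙ 0ℙ y = ⁻¹-involutive y
[p⊕x]⊕[p⊕y]≡x⊕y 1ℙ 1ℙ y = refl

parity-C2+C2 : ∀ a b → parity (a + b) ≡ 1ℙ → parity (a C 2 + b C 2) ≡ parity ((a + b) C 2)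
parity-C2+C2 a b odd = sym (begin
  parity ((a + b) C 2)                          ≡⟨ cong parity ([m+n]C2 a b) ⟩
  parity (a C 2 + b C 2 + a * b)                ≡⟨ +-homo-+ (a C 2 + b C 2) (a * b) ⟩
  parity (a C 2 + b C 2) ⊕ parity (a * b)       ≡⟨ cong (parity (a C 2 + b C 2) ⊕_) (*-homo-* a b) ⟩
  parity (a C 2 + b C 2) ⊕ (parity a ⊛ parity b) ≡⟨ cong (parity (a C 2 + b C 2) ⊕_) ab-even ⟩
  parity (a C 2 + b C 2) ⊕ 0ℙ                   ≡⟨ ⊕-identityʳ _ ⟩
  parity (a C 2 + b C 2)                        ∎)
  where
  ab-even : parity a ⊛ parity b ≡ 0ℙ
  ab-even = ⊕≡1ℙ⇒⊛≡0ℙ (parity a) (parity b) (trans (sym (+-homo-+ a b)) odd)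

monochromaticPairs : ∀ {n} → (Fin n → Bool) → (Fin n → Bool) → ℕ
monochromaticPairs {n} S c =
  ∑[ i < n ] ∑[ j < n ] indicator ((toℕ i <ᵇ toℕ j) ∧ S i ∧ S j ∧ not (c i xor c j))

monochromaticPairs≡C2+C2 : ∀ {n} (S c : Fin n → Bool) →
  monochromaticPairs S c ≡ count (λ i → S i ∧ c i) C 2 + count (λ i → S i ∧ not (c i)) C 2
monochromaticPairs≡C2+C2 {zero}  S c = refl
-- Vertex 0 is paired with exactly the later members of its own colour class.
monochromaticPairs≡C2+C2 {suc n} S c
  with S zero | c zero | monochromaticPairs≡C2+C2 (S ∘ suc) (c ∘ suc)
... | false | _     | ih = trans (cong (_+ monochromaticPairs (S ∘ suc) (c ∘ suc)) (sum-replicate-zero n)) ih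
... | true  | true  | ih = begin
  k′ + monochromaticPairs (S ∘ suc) (c ∘ suc) ≡⟨ cong₂ _+_ k′≡k ih ⟩
  k + (k C 2 + l C 2)                        ≡⟨ +-assoc k _ _ ⟨
  k + k C 2 + l C 2                          ≡⟨ cong (_+ l C 2) ([1+n]C2 k) ⟨
  suc k C 2 + l C 2                          ∎
  where
  k l k′ : ℕ
  k  = count (λ i → S (suc i) ∧ c (suc i))
  l  = count (λ i → S (suc i) ∧ not (c (suc i)))
  k′ = count (λ i → S (suc i) ∧ not (not (c (suc i))))
  k′≡k : k′ ≡ k
  k′≡k = sum-cong-≗ (λ i → cong (λ b → indicator (S (suc i) ∧ b)) (not-involutive (c (suc i))))
... | true  | false | ih = begin
  l + monochromaticPairs (S ∘ suc) (c ∘ suc) ≡⟨ cong (l +_) ih ⟩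
  l + (k C 2 + l C 2)                        ≡⟨ +-assoc l _ _ ⟨
  l + k C 2 + l C 2                          ≡⟨ cong (_+ l C 2) (+-comm l (k C 2)) ⟩
  k C 2 + l + l C 2                          ≡⟨ +-assoc (k C 2) l _ ⟩
  k C 2 + (l + l C 2)                        ≡⟨ cong (k C 2 +_) ([1+n]C2 l) ⟨
  k C 2 + suc l C 2                          ∎
  where
  k l : ℕ
  k = count (λ i → S (suc i) ∧ c (suc i))
  l = count (λ i → S (suc i) ∧ not (c (suc i)))

n<ᵇn≡false : ∀ n → (n <ᵇ n) ≡ false
n<ᵇn≡false zero    = refl
n<ᵇn≡false (suc n) = n<ᵇn≡false n

edgesIn-K⊎K≡monochromaticPairs : ∀ s t (S : Subset (s + t)) →
  edgesIn (K⊎K s t) S ≡ monochromaticPairs (lookup S) (λ k → toℕ k <ᵇ s)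
edgesIn-K⊎K≡monochromaticPairs s t S =
  trans (sum-map-allFin (s + t) λ i → List.sum (map (entry i) (allFin (s + t))))
        (sum-cong-≗ λ i → trans (sum-map-allFin (s + t) (entry i)) (sum-cong-≗ (same-term i)))
  where
  entry : Fin (s + t) → Fin (s + t) → ℕ
  entry i j = indicator ((toℕ i <ᵇ toℕ j) ∧ lookup S i ∧ lookup S j ∧ adj (K⊎K s t) i j)
  same-term : ∀ i j →
    entry i j ≡ indicator ((toℕ i <ᵇ toℕ j) ∧ lookup S i ∧ lookup S j ∧ sameSide s (toℕ i) (toℕ j))
  same-term i j with i ≟ j
  ... | yes refl rewrite n<ᵇn≡false (toℕ i) = refl
  ... | no _     = refl

count-++-first : ∀ {s t} (u : Subset s) (v : Subset t) →
  count (λ i → lookup (u ++ v) i ∧ (toℕ i <ᵇ s)) ≡ ∣ u ∣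
count-++-first {t = t} []      v = trans (sum-cong-≗ (λ i → cong indicator (∧-zeroʳ (lookup v i))))
                                 (sum-replicate-zero t)
count-++-first (x ∷ u) v = trans (cong₂ _+_ (cong indicator (∧-identityʳ x)) (count-++-first u v))
                                 (sym (∣x∷p∣ x u))

count-++-second : ∀ {s t} (u : Subset s) (v : Subset t) →
  count (λ i → lookup (u ++ v) i ∧ not (toℕ i <ᵇ s)) ≡ ∣ v ∣
count-++-second []      v = trans (sum-cong-≗ (λ i → cong indicator (∧-identityʳ (lookup v i))))
                                  (sym (∣p∣≡count v))
count-++-second (x ∷ u) v = cong₂ _+_ (cong indicator (∧-zeroʳ x)) (count-++-second u v)

edgesIn-K⊎K : ∀ {s t} (u : Subset s) (v : Subset t) →
  edgesIn (K⊎K s t) (u ++ v) ≡ ∣ u ∣ C 2 + ∣ v ∣ C 2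
edgesIn-K⊎K {s} {t} u v = begin
  edgesIn (K⊎K s t) (u ++ v)
    ≡⟨ edgesIn-K⊎K≡monochromaticPairs s t (u ++ v) ⟩
  monochromaticPairs (lookup (u ++ v)) (λ k → toℕ k <ᵇ s)
    ≡⟨ monochromaticPairs≡C2+C2 (lookup (u ++ v)) (λ k → toℕ k <ᵇ s) ⟩
  count (λ i → lookup (u ++ v) i ∧ (toℕ i <ᵇ s)) C 2
    + count (λ i → lookup (u ++ v) i ∧ not (toℕ i <ᵇ s)) C 2
    ≡⟨ cong₂ (λ a b → a C 2 + b C 2) (count-++-first u v) (count-++-second u v) ⟩
  ∣ u ∣ C 2 + ∣ v ∣ C 2 ∎

parity-edgesIn-K⊎K : ∀ s t {r} (S : Subset (s + t)) → parity r ≡ 1ℙ → ∣ S ∣ ≡ r →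
  parity (edgesIn (K⊎K s t) S) ≡ parity (r C 2)
parity-edgesIn-K⊎K s t {r} S odd ∣S∣≡r with splitAt s S
... | u , v , refl = begin
  parity (edgesIn (K⊎K s t) (u ++ v))   ≡⟨ cong parity (edgesIn-K⊎K u v) ⟩
  parity (∣ u ∣ C 2 + ∣ v ∣ C 2)         ≡⟨ parity-C2+C2 ∣ u ∣ ∣ v ∣ (trans (cong parity size) odd) ⟩
  parity ((∣ u ∣ + ∣ v ∣) C 2)           ≡⟨ cong (λ n → parity (n C 2)) size ⟩
  parity (r C 2)                        ∎
  where
  size : ∣ u ∣ + ∣ v ∣ ≡ r
  size = trans (sym (∣p++q∣ u v)) ∣S∣≡r

opposite-parities⇒isNeutral : ∀ {n r} (G : Graph n) (S₁ S₂ : Subset n) → ∣ S₁ ∣ ≡ r → ∣ S₂ ∣ ≡ r →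
  parity (edgesIn G S₁) ⊕ parity (edgesIn G S₂) ≡ 1ℙ → IsNeutral r G
opposite-parities⇒isNeutral G S₁ S₂ ∣S₁∣≡r ∣S₂∣≡r opposite = not-complete , not-void
  where
  not-complete : ¬ IsComplete _ G
  not-complete complete = contradiction
    (trans (sym opposite) (cong₂ _⊕_ (to (Odd⇔parity≡1ℙ (edgesIn G S₁)) (complete S₁ ∣S₁∣≡r))
                                     (to (Odd⇔parity≡1ℙ (edgesIn G S₂)) (complete S₂ ∣S₂∣≡r))))
    λ ()
  not-void : ¬ IsVoid _ G
  not-void void = contradiction
    (trans (sym opposite) (cong₂ _⊕_ (to (Even⇔parity≡0ℙ (edgesIn G S₁)) (void S₁ ∣S₁∣≡r))
                                     (to (Even⇔parity≡0ℙ (edgesIn G S₂)) (void S₂ ∣S₂∣≡r))))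
    λ ()

≤-+-split : ∀ {n p q} → n ≤ p + q → ∃₂ λ a b → a ≤ p × b ≤ q × a + b ≡ n
≤-+-split {n}     {zero}  n≤q = 0 , n , z≤n , n≤q , refl
≤-+-split {zero}  {suc p} _   = 0 , 0 , z≤n , z≤n , refl
≤-+-split {suc n} {suc p} (s≤s n≤p+q) with ≤-+-split {p = p} n≤p+q
... | a , b , a≤p , b≤q , a+b≡n = suc a , b , s≤s a≤p , b≤q , cong suc a+b≡n

parity-[1+a,b]⊕parity-[a,1+b] : ∀ a b →
  parity (suc a C 2 + b C 2) ⊕ parity (a C 2 + suc b C 2) ≡ parity (a + b)
parity-[1+a,b]⊕parity-[a,1+b] a b = begin
  parity (suc a C 2 + b C 2) ⊕ parity (a C 2 + suc b C 2)
    ≡⟨ cong₂ (λ x y → parity x ⊕ parity y) first second ⟩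
  parity (P + a) ⊕ parity (P + b)
    ≡⟨ cong₂ _⊕_ (+-homo-+ P a) (+-homo-+ P b) ⟩
  (parity P ⊕ parity a) ⊕ (parity P ⊕ parity b)
    ≡⟨ [p⊕x]⊕[p⊕y]≡x⊕y (parity P) (parity a) (parity b) ⟩
  parity a ⊕ parity b
    ≡⟨ +-homo-+ a b ⟨
  parity (a + b) ∎
  where
  P : ℕ
  P = a C 2 + b C 2
  first : suc a C 2 + b C 2 ≡ P + a
  first = trans (cong (_+ b C 2) ([1+n]C2 a)) (move-first a (a C 2) (b C 2))
    where
    move-first : ∀ a x y → a + x + y ≡ x + y + a
    move-first = solve-∀
  second : a C 2 + suc b C 2 ≡ P + b
  second = trans (cong (a C 2 +_) ([1+n]C2 b)) (move-middle b (a C 2) (b C 2))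
    where
    move-middle : ∀ b x y → x + (b + y) ≡ x + y + b
    move-middle = solve-∀

K⊎K-subset : ∀ {s t a b} → a ≤ s → b ≤ t →
  Σ (Subset (s + t)) λ S → ∣ S ∣ ≡ a + b × edgesIn (K⊎K s t) S ≡ a C 2 + b C 2
K⊎K-subset a≤s b≤t with subset-of-size a≤s | subset-of-size b≤t
... | u , refl | v , refl = u ++ v , ∣p++q∣ u v , edgesIn-K⊎K u v

K⊎K-isNeutral : ∀ {s t r} → 1 ≤ s → 1 ≤ t → 1 ≤ r → r < s + t → parity r ≡ 0ℙ →
  IsNeutral r (K⊎K s t)
K⊎K-isNeutral {suc s} {suc t} {suc r} _ _ _ (s≤s 1+r≤s+1+t) even
  with ≤-+-split {p = s} {q = t} (s≤s⁻¹ (subst (suc r ≤_) (+-suc s t) 1+r≤s+1+t))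
... | a , b , a≤s , b≤t , a+b≡r
  with K⊎K-subset {a = suc a} {b = b} (s≤s a≤s) (m≤n⇒m≤1+n b≤t)
     | K⊎K-subset {a = a} {b = suc b} (m≤n⇒m≤1+n a≤s) (s≤s b≤t)
... | S₁ , ∣S₁∣≡1+a+b , E₁ | S₂ , ∣S₂∣≡a+1+b , E₂ =
  opposite-parities⇒isNeutral G S₁ S₂
    (trans ∣S₁∣≡1+a+b (cong suc a+b≡r))
    (trans ∣S₂∣≡a+1+b (trans (+-suc a b) (cong suc a+b≡r)))
    opposite
  where
  G : Graph (suc s + suc t)
  G = K⊎K (suc s) (suc t)
  opposite : parity (edgesIn G S₁) ⊕ parity (edgesIn G S₂) ≡ 1ℙ
  opposite = begin
    parity (edgesIn G S₁) ⊕ parity (edgesIn G S₂)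
      ≡⟨ cong₂ (λ x y → parity x ⊕ parity y) E₁ E₂ ⟩
    parity (suc a C 2 + b C 2) ⊕ parity (a C 2 + suc b C 2)
      ≡⟨ parity-[1+a,b]⊕parity-[a,1+b] a b ⟩
    parity (a + b)
      ≡⟨ cong parity a+b≡r ⟩
    parity r
      ≡⟨ suc-homo-⁻¹ r ⟨
    parity (suc r) ⁻¹
      ≡⟨ cong _⁻¹ even ⟩
    1ℙ ∎

theorem10 : (s t r : ℕ) → 1 ≤ s → 1 ≤ t → 3 ≤ r → r < s + t →
    (Even r → IsNeutral r (K⊎K s t))
    × (r % 4 ≡ 1 → IsVoid r (K⊎K s t))
    × (r % 4 ≡ 3 → IsComplete r (K⊎K s t))
theorem10 s t r 1≤s 1≤t 3≤r r<s+t = neutral , void , complete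
  where
  neutral : Even r → IsNeutral r (K⊎K s t)
  neutral even = K⊎K-isNeutral 1≤s 1≤t (≤-trans (s≤s z≤n) 3≤r) r<s+t (to (Even⇔parity≡0ℙ r) even)

  parity-edgesIn : ∀ k → r % 4 ≡ k → parity k ≡ 1ℙ → ∀ S → ∣ S ∣ ≡ r →
    parity (edgesIn (K⊎K s t) S) ≡ parity (k C 2)
  parity-edgesIn k r%4≡k k-odd S ∣S∣≡r = begin
    parity (edgesIn (K⊎K s t) S) ≡⟨ parity-edgesIn-K⊎K s t S r-odd ∣S∣≡r ⟩
    parity (r C 2)               ≡⟨ 4-periodic⇒≡%4 (λ n → parity (n C 2)) parity-[4+n]C2 r ⟩
    parity ((r % 4) C 2)         ≡⟨ cong (λ n → parity (n C 2)) r%4≡k ⟩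
    parity (k C 2)               ∎
    where
    r-odd : parity r ≡ 1ℙ
    r-odd = trans (4-periodic⇒≡%4 parity (λ _ → refl) r) (trans (cong parity r%4≡k) k-odd)

  void : r % 4 ≡ 1 → IsVoid r (K⊎K s t)
  void r%4≡1 S ∣S∣≡r = from (Even⇔parity≡0ℙ (edgesIn (K⊎K s t) S)) (parity-edgesIn 1 r%4≡1 refl S ∣S∣≡r)

  complete : r % 4 ≡ 3 → IsComplete r (K⊎K s t)
  complete r%4≡3 S ∣S∣≡r = from (Odd⇔parity≡1ℙ (edgesIn (K⊎K s t) S)) (parity-edgesIn 3 r%4≡3 refl S ∣S∣≡r)
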